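{- Let $G$ be a finite group and let $Max_G=\{x_1,\dots,x_m\}$ be an essential cyclic set of $G$ with $m\geq 4$ and $icn(G)\geq 2$. Then $rc(\Gamma_G^e)\geq 3$.
   Context: Let $G$ be a finite group with identity $e$. The enhanced power graph $\Gamma_G^e$ has vertex set $G$, two distinct vertices $x,y$ being adjacent iff $x,y\in\langle z\rangle$ for some $z\in G$. For a connected graph $\Gamma$, an edge-colouring $\zeta:E(\Gamma)\to\{1,\dots,k\}$ (not necessarily proper) is a rainbow $k$-colouring if every pair of distinct vertices is joined by a path whose edges have pairwise distinct colours; $rc(\Gamma)$ is the minimum such $k$. An essential cyclic set $Max_G=\{x_1,\dots,x_m\}$ is a set of elements of $G$ such that $\langle x_1\rangle,\dots,\langle x_m\rangle$ are pairwise distinct and are exactly the maximal cyclic subgroups of $G$. The independence cyclic set is $ics(G)=\{x_i\in Max_G:\langle x_i\rangle\cap\langle x_j\rangle=\{e\}\text{ for all }j\neq i\}$ and $icn(G)=|ics(G)|$. -}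

module Defs where

open import Level using (0ℓ)
open import Data.Nat using (ℕ; zero; suc)
open import Data.Integer using (ℤ; +_; -[1+_])
open import Data.Fin using (Fin)
open import Data.List using (List; []; _∷_)
open import Data.List.Relation.Unary.Unique.Propositional using (Unique)
open import Data.Product using (Σ; ∃; _×_; _,_)
open import Relation.Nullary using (¬_)
open import Relation.Binary.PropositionalEquality using (_≡_; _≢_)
open import Algebra.Structures using (IsGroup)

-- A finite group of order n: carrier Fin n, with group laws w.r.t. _≡_.
-- (Every finite group is isomorphic to one of this form.)
record FiniteGroup : Set where
  field
    order   : ℕ
    _∙_     : Fin order → Fin order → Fin order
    ε       : Fin order
    _⁻¹     : Fin order → Fin order
    isGroup : IsGroup _≡_ _∙_ ε _⁻¹

module _ (G : FiniteGroup) where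
  open FiniteGroup G

  El : Set
  El = Fin order

  powℕ : El → ℕ → El
  powℕ z zero    = ε
  powℕ z (suc k) = z ∙ powℕ z k

  powℤ : El → ℤ → El
  powℤ z (+ k)      = powℕ z k
  powℤ z -[1+ k ]   = (powℕ z (suc k)) ⁻¹

  _∈⟨_⟩ : El → El → Set
  x ∈⟨ z ⟩ = ∃ λ (k : ℤ) → powℤ z k ≡ x

  _⊆⟨⟩_ : El → El → Set
  x ⊆⟨⟩ z = ∀ g → g ∈⟨ x ⟩ → g ∈⟨ z ⟩

  _≐⟨⟩_ : El → El → Set
  x ≐⟨⟩ z = (x ⊆⟨⟩ z) × (z ⊆⟨⟩ x)

  MaximalCyclic : El → Set
  MaximalCyclic x = ∀ z → x ⊆⟨⟩ z → z ⊆⟨⟩ x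

  record IsEssentialCyclicSet (m : ℕ) (xs : Fin m → El) : Set where
    field
      distinct : ∀ i j → i ≢ j → ¬ (xs i ≐⟨⟩ xs j)
      maximal  : ∀ i → MaximalCyclic (xs i)
      complete : ∀ z → MaximalCyclic z → ∃ λ i → z ≐⟨⟩ xs i

  InIcs : (m : ℕ) → (Fin m → El) → Fin m → Set
  InIcs m xs i = ∀ j → j ≢ i → ∀ g → g ∈⟨ xs i ⟩ → g ∈⟨ xs j ⟩ → g ≡ ε

  IcnAtLeast2 : (m : ℕ) → (Fin m → El) → Set
  IcnAtLeast2 m xs = Σ (Fin m) λ i → Σ (Fin m) λ j → i ≢ j × InIcs m xs i × InIcs m xs j

  EAdj : El → El → Set
  EAdj x y = x ≢ y × ∃ λ z → x ∈⟨ z ⟩ × y ∈⟨ z ⟩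

module _ {n : ℕ} (Adj : Fin n → Fin n → Set) where

  -- An edge colouring with colours Fin k (≅ {1,…,k}); colour of edge {x,y}
  -- is c x y, required symmetric on edges (edges are unordered).
  EdgeColouring : ℕ → Set
  EdgeColouring k = Σ (Fin n → Fin n → Fin k) λ c → ∀ x y → Adj x y → c x y ≡ c y x

  data ColPath {k : ℕ} (c : Fin n → Fin n → Fin k)
       : Fin n → Fin n → List (Fin n) → List (Fin k) → Set where
    nil  : ∀ {x} → ColPath c x x (x ∷ []) []
    cons : ∀ {x y z vs cs} → Adj x y → ColPath c y z vs cs →
           ColPath c x z (x ∷ vs) (c x y ∷ cs)

  IsRainbowColouring : (k : ℕ) → EdgeColouring k → Set
  IsRainbowColouring k (c , _) =
    ∀ x y → x ≢ y → ∃ λ vs → ∃ λ cs → ColPath c x y vs cs × Unique vs × Unique cs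

  -- rc(Γ) ≥ r  (rc = least k admitting a rainbow k-colouring)
  rc≥ : ℕ → Set
  rc≥ r = ∀ k (ζ : EdgeColouring k) → IsRainbowColouring k ζ → r Data.Nat.≤ k

module Submission where

-- Let x_i, x_j be two members of ics(G) and x_t a third
-- generator (m ≥ 3 suffices).  Every neighbour y of a generator x_s in
-- Γ_G^e lies in ⟨x_s⟩, because ⟨x_s⟩ is a maximal cyclic subgroup.  Hence
-- if x_a ∈ ics(G) and b ≠ a, then x_a and x_b are non-adjacent and their
-- only possible common neighbour is e.  In any rainbow colouring the
-- rainbow path between two such vertices either has length ≥ 3 (so at
-- least three colours exist) or is x_a – e – x_b, whence the edges e x_a
-- and e x_b get different colours.  Applied to the pairs (i,j), (i,t),
-- (j,t), the three edges e x_i, e x_j, e x_t get pairwise distinct colours.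

open import Defs
open import Data.Nat using (ℕ; zero; suc; _+_; _*_; _≤_; s≤s)
open import Data.Nat.Properties using (+-comm)
open import Data.Integer using (+_; -[1+_])
open import Data.Fin using (Fin)
import Data.Fin as F
open import Data.Fin.Properties using (injective⇒≤)
open import Data.List using (_∷_)
open import Data.List.Relation.Unary.Unique.Propositional using (Unique)
open import Data.List.Relation.Unary.All using ([]; _∷_)
open import Data.List.Relation.Unary.AllPairs using (_∷_)
open import Data.Product using (Σ; _×_; _,_)
open import Data.Sum using (_⊎_; inj₁; inj₂)
open import Data.Empty using (⊥-elim)
open import Relation.Nullary using (¬_)
open import Relation.Binary.PropositionalEquality
open import Algebra.Structures using (IsGroup)
open import Algebra.Bundles using (Group)
import Algebra.Properties.Group as GroupProperties
import Algebra.Properties.Monoid.Mult as MonoidMult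

three-distinct⇒3≤ : ∀ {k} (a b c : Fin k) → a ≢ b → a ≢ c → b ≢ c → 3 ≤ k
three-distinct⇒3≤ {k} a b c a≢b a≢c b≢c = injective⇒≤ {f = f} f-injective
  where
  f : Fin 3 → Fin k
  f F.zero                    = a
  f (F.suc F.zero)            = b
  f (F.suc (F.suc F.zero))    = c

  f-injective : ∀ {u v} → f u ≡ f v → u ≡ v
  f-injective {F.zero}                 {F.zero}                 _ = refl
  f-injective {F.zero}                 {F.suc F.zero}           e = ⊥-elim (a≢b e)
  f-injective {F.zero}                 {F.suc (F.suc F.zero)}   e = ⊥-elim (a≢c e)
  f-injective {F.suc F.zero}           {F.zero}                 e = ⊥-elim (a≢b (sym e))
  f-injective {F.suc F.zero}           {F.suc F.zero}           _ = refl
  f-injective {F.suc F.zero}           {F.suc (F.suc F.zero)}   e = ⊥-elim (b≢c e)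
  f-injective {F.suc (F.suc F.zero)}   {F.zero}                 e = ⊥-elim (a≢c (sym e))
  f-injective {F.suc (F.suc F.zero)}   {F.suc F.zero}           e = ⊥-elim (b≢c (sym e))
  f-injective {F.suc (F.suc F.zero)}   {F.suc (F.suc F.zero)}   _ = refl

third-index : ∀ {n} (i j : Fin (suc (suc (suc n)))) →
              Σ (Fin (suc (suc (suc n)))) λ t → t ≢ i × t ≢ j
third-index F.zero            F.zero            = F.suc F.zero , (λ ()) , (λ ())
third-index F.zero            (F.suc F.zero)    = F.suc (F.suc F.zero) , (λ ()) , (λ ())
third-index F.zero            (F.suc (F.suc _)) = F.suc F.zero , (λ ()) , (λ ())
third-index (F.suc F.zero)    F.zero            = F.suc (F.suc F.zero) , (λ ()) , (λ ())
third-index (F.suc (F.suc _)) F.zero            = F.suc F.zero , (λ ()) , (λ ())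
third-index (F.suc _)         (F.suc _)         = F.zero , (λ ()) , (λ ())

module RainbowHub {n : ℕ} (Adj : Fin n → Fin n → Set) where

  -- x and y are distinct, non-adjacent, and the hub o is their only
  -- possible common neighbour; so every x–y path has length ≥ 3 or is x–o–y.
  record Separated (o x y : Fin n) : Set where
    field
      distinct     : x ≢ y
      non-adjacent : ¬ Adj x y
      only-via-hub : ∀ w → Adj x w → Adj w y → w ≡ o

  separated-path-colours :
    ∀ {k} (c : Fin n → Fin n → Fin k) → (∀ x y → Adj x y → c x y ≡ c y x) →
    ∀ {o x y vs cs} → Separated o x y → ColPath Adj c x y vs cs → Unique cs →
    3 ≤ k ⊎ c o x ≢ c o y
  separated-path-colours c c-sym sep nil _ = ⊥-elim (Separated.distinct sep refl)
  separated-path-colours c c-sym sep (cons x~y nil) _ =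
    ⊥-elim (Separated.non-adjacent sep x~y)
  separated-path-colours c c-sym {x = x} sep
      (cons {y = w} x~w (cons w~y nil)) ((cxw≢cwy ∷ []) ∷ _)
    with Separated.only-via-hub sep w x~w w~y
  ... | refl = inj₂ λ cwx≡cwy → cxw≢cwy (trans (c-sym x w x~w) cwx≡cwy)
  separated-path-colours c c-sym sep (cons _ (cons _ (cons _ _)))
      ((c₁≢c₂ ∷ c₁≢c₃ ∷ _) ∷ (c₂≢c₃ ∷ _) ∷ _) =
    inj₁ (three-distinct⇒3≤ _ _ _ c₁≢c₂ c₁≢c₃ c₂≢c₃)

  -- If three vertices are pairwise separated by a common hub, every
  -- rainbow colouring uses at least three colours: the three spokes at
  -- the hub must receive pairwise distinct colours.
  pairwise-separated⇒rc≥3 : ∀ {o x y z} →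
    Separated o x y → Separated o x z → Separated o y z → rc≥ Adj 3
  pairwise-separated⇒rc≥3 {o} sep-xy sep-xz sep-yz k (c , c-sym) rainbow
    with spokes sep-xy | spokes sep-xz | spokes sep-yz
    where
    spokes : ∀ {u v} → Separated o u v → 3 ≤ k ⊎ c o u ≢ c o v
    spokes {u} {v} sep with rainbow u v (Separated.distinct sep)
    ... | _ , _ , path , _ , rainbow-colours =
      separated-path-colours c c-sym sep path rainbow-colours
  ... | inj₁ 3≤k | _        | _        = 3≤k
  ... | _        | inj₁ 3≤k | _        = 3≤k
  ... | _        | _        | inj₁ 3≤k = 3≤k
  ... | inj₂ xy  | inj₂ xz  | inj₂ yz  = three-distinct⇒3≤ _ _ _ xy xz yz

module CyclicSubgroups (G : FiniteGroup) where
  open FiniteGroup G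
  open IsGroup isGroup using (identityʳ)

  group : Group _ _
  group = record { isGroup = isGroup }

  open GroupProperties group using (ε⁻¹≈ε; ⁻¹-involutive; ⁻¹-anti-homo-∙)
  open MonoidMult (Group.monoid group) using (×-homo-+; ×-assocˡ) renaming (_×_ to _×ᴹ_)

  -- powℕ G z n is the monoid multiple n ×ᴹ z, so the exponent laws come
  -- from the library.
  powℕ≡× : ∀ z n → powℕ G z n ≡ n ×ᴹ z
  powℕ≡× z zero    = refl
  powℕ≡× z (suc n) = cong (z ∙_) (powℕ≡× z n)

  pow-add : ∀ x p q → powℕ G x (p + q) ≡ powℕ G x p ∙ powℕ G x q
  pow-add x p q = begin
    powℕ G x (p + q)          ≡⟨ powℕ≡× x (p + q) ⟩
    (p + q) ×ᴹ x              ≡⟨ ×-homo-+ x p q ⟩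
    (p ×ᴹ x) ∙ (q ×ᴹ x)       ≡⟨ sym (cong₂ _∙_ (powℕ≡× x p) (powℕ≡× x q)) ⟩
    powℕ G x p ∙ powℕ G x q   ∎
    where open ≡-Reasoning

  pow-mult : ∀ z p q → powℕ G (powℕ G z p) q ≡ powℕ G z (q * p)
  pow-mult z p q = begin
    powℕ G (powℕ G z p) q     ≡⟨ powℕ≡× (powℕ G z p) q ⟩
    q ×ᴹ powℕ G z p           ≡⟨ cong (q ×ᴹ_) (powℕ≡× z p) ⟩
    q ×ᴹ (p ×ᴹ z)             ≡⟨ ×-assocˡ z q p ⟩
    (q * p) ×ᴹ z              ≡⟨ sym (powℕ≡× z (q * p)) ⟩
    powℕ G z (q * p)          ∎
    where open ≡-Reasoning

  pow-suc-right : ∀ x n → powℕ G x n ∙ x ≡ powℕ G x (suc n)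
  pow-suc-right x n = begin
    powℕ G x n ∙ x             ≡⟨ cong (powℕ G x n ∙_) (sym (identityʳ x)) ⟩
    powℕ G x n ∙ powℕ G x 1    ≡⟨ sym (pow-add x n 1) ⟩
    powℕ G x (n + 1)           ≡⟨ cong (powℕ G x) (+-comm n 1) ⟩
    powℕ G x (suc n)           ∎
    where open ≡-Reasoning

  pow-inverse : ∀ x n → powℕ G (x ⁻¹) n ≡ (powℕ G x n) ⁻¹
  pow-inverse x zero    = sym ε⁻¹≈ε
  pow-inverse x (suc n) = begin
    (x ⁻¹) ∙ powℕ G (x ⁻¹) n   ≡⟨ cong ((x ⁻¹) ∙_) (pow-inverse x n) ⟩
    (x ⁻¹) ∙ ((powℕ G x n) ⁻¹) ≡⟨ sym (⁻¹-anti-homo-∙ (powℕ G x n) x) ⟩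
    (powℕ G x n ∙ x) ⁻¹        ≡⟨ cong _⁻¹ (pow-suc-right x n) ⟩
    (powℕ G x (suc n)) ⁻¹      ∎
    where open ≡-Reasoning

  ∈⟨⟩-refl : ∀ x → _∈⟨_⟩ G x x
  ∈⟨⟩-refl x = + 1 , identityʳ x

  ε∈⟨⟩ : ∀ z → _∈⟨_⟩ G ε z
  ε∈⟨⟩ z = + 0 , refl

  ∈⟨⟩-inverse : ∀ {g z} → _∈⟨_⟩ G g z → _∈⟨_⟩ G (g ⁻¹) z
  ∈⟨⟩-inverse (+ zero , refl)    = + 0 , sym ε⁻¹≈ε
  ∈⟨⟩-inverse (+ suc p , refl)   = -[1+ p ] , refl
  ∈⟨⟩-inverse (-[1+ p ] , refl)  = + suc p , sym (⁻¹-involutive _)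

  ∈⟨⟩-powℕ : ∀ {x z} q → _∈⟨_⟩ G x z → _∈⟨_⟩ G (powℕ G x q) z
  ∈⟨⟩-powℕ {z = z} q (+ p , refl) = + (q * p) , sym (pow-mult z p q)
  ∈⟨⟩-powℕ {z = z} q (-[1+ p ] , refl) =
    subst (λ g → _∈⟨_⟩ G g z) (sym (pow-inverse (powℕ G z (suc p)) q))
          (∈⟨⟩-inverse (∈⟨⟩-powℕ q (+ suc p , refl)))

  ∈⟨⟩⇒⊆ : ∀ {x z} → _∈⟨_⟩ G x z → _⊆⟨⟩_ G x z
  ∈⟨⟩⇒⊆ x∈z _ (+ q , refl)      = ∈⟨⟩-powℕ q x∈z
  ∈⟨⟩⇒⊆ x∈z _ (-[1+ q ] , refl) = ∈⟨⟩-inverse (∈⟨⟩-powℕ (suc q) x∈z)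

  -- Any cyclic subgroup containing a maximal cyclic ⟨x⟩ is contained in it;
  -- in particular every neighbour of x in Γ_G^e lies in ⟨x⟩.
  maximal-absorbs : ∀ {x y z} → MaximalCyclic G x →
                    _∈⟨_⟩ G x z → _∈⟨_⟩ G y z → _∈⟨_⟩ G y x
  maximal-absorbs {y = y} {z} x-max x∈z y∈z = x-max z (∈⟨⟩⇒⊆ x∈z) y y∈z

module EssentialCyclicSet (G : FiniteGroup) {m : ℕ} {xs : Fin m → El G}
                          (ecs : IsEssentialCyclicSet G m xs) where
  open FiniteGroup G
  open CyclicSubgroups G
  open IsEssentialCyclicSet ecs
  open RainbowHub (EAdj G)

  generators-distinct : ∀ {i j} → i ≢ j → xs i ≢ xs j
  generators-distinct {i} {j} i≢j xsᵢ≡xsⱼ =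
    distinct i j i≢j (subst (λ v → _≐⟨⟩_ G (xs i) v) xsᵢ≡xsⱼ (same , same))
    where
    same : _⊆⟨⟩_ G (xs i) (xs i)
    same _ g∈ = g∈

  -- When another generator exists, no generator is e: ⟨e⟩ lies in every
  -- cyclic subgroup, so maximality would make two of them equal.
  generator≢ε : ∀ {i j} → i ≢ j → xs i ≢ ε
  generator≢ε {i} {j} i≢j xsᵢ≡ε = distinct i j i≢j (xsᵢ⊆xsⱼ , maximal i (xs j) xsᵢ⊆xsⱼ)
    where
    xsᵢ⊆xsⱼ : _⊆⟨⟩_ G (xs i) (xs j)
    xsᵢ⊆xsⱼ = ∈⟨⟩⇒⊆ (subst (λ g → _∈⟨_⟩ G g (xs j)) (sym xsᵢ≡ε) (ε∈⟨⟩ (xs j)))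

  ics-separated : ∀ {i j} → InIcs G m xs i → j ≢ i → Separated ε (xs i) (xs j)
  ics-separated {i} {j} icsᵢ j≢i = record
    { distinct     = generators-distinct (λ i≡j → j≢i (sym i≡j))
    ; non-adjacent = λ { (_ , z , xsᵢ∈z , xsⱼ∈z) →
        generator≢ε j≢i (icsᵢ j j≢i (xs j)
          (maximal-absorbs (maximal i) xsᵢ∈z xsⱼ∈z) (∈⟨⟩-refl (xs j))) }
    ; only-via-hub = λ { w (_ , z , xsᵢ∈z , w∈z) (_ , z′ , w∈z′ , xsⱼ∈z′) →
        icsᵢ j j≢i w (maximal-absorbs (maximal i) xsᵢ∈z w∈z)
                     (maximal-absorbs (maximal j) xsⱼ∈z′ w∈z′) }
    }

proposition2p20 : (G : FiniteGroup) (m : ℕ) (xs : Fin m → El G) →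
                  IsEssentialCyclicSet G m xs → 4 ≤ m → IcnAtLeast2 G m xs →
                  rc≥ (EAdj G) 3
proposition2p20 G (suc (suc (suc _))) xs ecs (s≤s (s≤s (s≤s _))) (i , j , i≢j , icsᵢ , icsⱼ)
  with third-index i j
... | t , t≢i , t≢j =
  pairwise-separated⇒rc≥3
    (ics-separated icsᵢ (λ j≡i → i≢j (sym j≡i)))
    (ics-separated icsᵢ t≢i)
    (ics-separated icsⱼ t≢j)
  where
  open RainbowHub (EAdj G)
  open EssentialCyclicSet G ecs
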